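{- Let $\mathcal{A}$ be a nice GFG-tNCW. The relation $H$ on the safe components of $\mathcal{A}$ is transitive: for all safe components $S,S',S''$, if $H(S,S')$ and $H(S',S'')$ then $H(S,S'')$.
   Context: A tNCW is $\mathcal{A}=\langle \Sigma,Q,q_0,\delta,\alpha\rangle$ with finite alphabet $\Sigma$, finite state set $Q$, initial state $q_0$, total transition function $\delta:Q\times\Sigma\to 2^Q\setminus\{\emptyset\}$ with transition relation $\Delta=\{\langle q,\sigma,s\rangle: s\in\delta(q,\sigma)\}$, and $\alpha\subseteq\Delta$ ($\alpha$-transitions; the rest are $\bar\alpha$-transitions); $\delta^{\bar\alpha}(q,\sigma)$ is the set of $\sigma$-successors of $q$ via $\bar\alpha$-transitions. A run on $w=\sigma_1\sigma_2\cdots$ is $r_0r_1\cdots$ with $r_0=q_0$, $r_{i+1}\in\delta(r_i,\sigma_{i+1})$, accepting iff it traverses $\alpha$-transitions only finitely often. $\mathcal{A}^q$ is $\mathcal{A}$ with initial state $q$. $\mathcal{A}$ is GFG if there is $f:\Sigma^*\to Q$ with $f(\epsilon)=q_0$, $\langle f(u),\sigma,f(u\sigma)\rangle\in\Delta$ for all $u,\sigma$, and for every $w\in L(\mathcal{A})$ the run $f(w[1,0]),f(w[1,1]),\dots$ is accepting; a state $q$ is GFG if $\mathcal{A}^q$ is. A run is safe if it uses no $\alpha$-transition; $L_{safe}(\mathcal{A}^q)$ is the set of infinite words with a safe run from $q$. $q\sim s$ iff $L(\mathcal{A}^q)=L(\mathcal{A}^s)$; $q\precsim s$ iff $q\sim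 s$ and $L_{safe}(\mathcal{A}^q)\subseteq L_{safe}(\mathcal{A}^s)$. Safe components are the SCCs of the graph on $Q$ with an edge $q\to q'$ iff some $\bar\alpha$-transition $\langle q,\sigma,q'\rangle$ exists. $\mathcal{A}$ is semantically deterministic if any two $\sigma$-successors of a state are $\sim$-equivalent; safe deterministic if $|\delta^{\bar\alpha}(q,\sigma)|\le1$; normal if a path of $\bar\alpha$-transitions from $q$ to $s$ implies one from $s$ to $q$. A GFG-tNCW is nice if all states are reachable and GFG and it is normal, safe deterministic and semantically deterministic. For safe components $S,S'$, $H(S,S')$ holds iff there are $q\in S$ and $q'\in S'$ with $q\precsim q'$. -}

module Defs where

open import Data.Nat using (ℕ; zero; suc; _≥_)
open import Data.Fin using (Fin)
open import Data.Fin.Subset using (Subset; _∈_)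
open import Data.Bool using (Bool; true; false; T)
open import Data.List using (List; []; _∷ʳ_)
open import Data.Product using (Σ; ∃; _×_; _,_)
open import Relation.Nullary using (¬_)
open import Relation.Binary.PropositionalEquality using (_≡_)
open import Relation.Binary.Construct.Closure.ReflexiveTransitive using (Star)

record tNCW : Set where
  field
    nΣ    : ℕ
    nQ    : ℕ
    q₀    : Fin nQ
    Δ     : Fin nQ → Fin nΣ → Fin nQ → Bool
    α     : Fin nQ → Fin nΣ → Fin nQ → Bool
    total : ∀ q σ → ∃ λ s → T (Δ q σ s)
    α⊆Δ   : ∀ q σ s → T (α q σ s) → T (Δ q σ s)

module _ (A : tNCW) where
  open tNCW A

  Q : Set
  Q = Fin nQ

  Letter : Set
  Letter = Fin nΣ

  -- infinite words; w i is the (i+1)-th letter σ_{i+1}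
  Word : Set
  Word = ℕ → Letter

  IsRun : Q → Word → (ℕ → Q) → Set
  IsRun q w r = (r 0 ≡ q) × (∀ i → T (Δ (r i) (w i) (r (suc i))))

  Accepting : Word → (ℕ → Q) → Set
  Accepting w r = ∃ λ N → ∀ i → i ≥ N → ¬ T (α (r i) (w i) (r (suc i)))

  SafeRun : Word → (ℕ → Q) → Set
  SafeRun w r = ∀ i → ¬ T (α (r i) (w i) (r (suc i)))

  Lang : Q → Word → Set
  Lang q w = ∃ λ r → IsRun q w r × Accepting w r

  LangSafe : Q → Word → Set
  LangSafe q w = ∃ λ r → IsRun q w r × SafeRun w r

  prefix : Word → ℕ → List Letter
  prefix w zero = []
  prefix w (suc i) = prefix w i ∷ʳ w i

  GFGState : Q → Set
  GFGState q = Σ (List Letter → Q) λ f →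
      (f [] ≡ q)
    × (∀ u σ → T (Δ (f u) σ (f (u ∷ʳ σ))))
    × (∀ w → Lang q w → Accepting w (λ i → f (prefix w i)))

  IsGFG : Set
  IsGFG = GFGState q₀

  _∼_ : Q → Q → Set
  q ∼ s = ∀ w → (Lang q w → Lang s w) × (Lang s w → Lang q w)

  _≾_ : Q → Q → Set
  q ≾ s = (q ∼ s) × (∀ w → LangSafe q w → LangSafe s w)

  SafeEdge : Q → Q → Set
  SafeEdge q q' = ∃ λ σ → T (Δ q σ q') × ¬ T (α q σ q')

  SafeReach : Q → Q → Set
  SafeReach = Star SafeEdge

  Edge : Q → Q → Set
  Edge q q' = ∃ λ σ → T (Δ q σ q')

  Reachable : Q → Set
  Reachable q = Star Edge q₀ q

  IsSafeComponent : Subset nQ → Set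
  IsSafeComponent S = ∃ λ q → ∀ q' →
      (q' ∈ S → SafeReach q q' × SafeReach q' q)
    × (SafeReach q q' × SafeReach q' q → q' ∈ S)

  SemanticallyDeterministic : Set
  SemanticallyDeterministic = ∀ q σ s s' → T (Δ q σ s) → T (Δ q σ s') → s ∼ s'

  SafeDeterministic : Set
  SafeDeterministic = ∀ q σ s s' →
    T (Δ q σ s) → ¬ T (α q σ s) → T (Δ q σ s') → ¬ T (α q σ s') → s ≡ s'

  Normal : Set
  Normal = ∀ q s → SafeReach q s → SafeReach s q

  Nice : Set
  Nice = IsGFG
       × (∀ q → Reachable q)
       × (∀ q → GFGState q)
       × Normal
       × SafeDeterministic
       × SemanticallyDeterministic

  H : Subset nQ → Subset nQ → Set
  H S S' = ∃ λ q → ∃ λ q' → (q ∈ S) × (q' ∈ S') × (q ≾ q')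

module Submission where

-- The key fact is
-- that ≾ is a simulation of the safe transition graph: if p ≾ r and p reaches p' by a
-- safe σ-transition, then r reaches some r' by a safe σ-transition with p' ≾ r'. Indeed,
-- normality makes L_safe(p') nonempty, so some σw lies in L_safe(p) ⊆ L_safe(r), which
-- yields r'; semantic determinism gives p' ∼ r', and safe determinism makes r' the only
-- safe σ-successor of r, whence L_safe(p') ⊆ L_safe(r').
-- Given q ≾ p with p ∈ S' and p' ≾ r with p' ∈ S', r ∈ S'', follow a safe path from p'
-- to p inside S' and simulate it from r: this ends in some r' with p ≾ r', and r' lies
-- in S'' since by normality it safely reaches r back. Then q ≾ p ≾ r'.

open import Defs
open import Data.Fin.Subset using (Subset; _∈_)
open import Data.Nat using (ℕ; zero; suc; s≤s)
open import Data.Nat.Properties using (≤-trans; n≤1+n)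
open import Data.Product using (Σ; ∃; _×_; _,_; proj₁; proj₂)
open import Data.Bool using (T)
open import Relation.Nullary using (¬_)
open import Relation.Binary.PropositionalEquality using (refl; subst)
open import Relation.Binary.Construct.Closure.ReflexiveTransitive using (ε; _◅_; _◅◅_)

tail : {X : Set} → (ℕ → X) → ℕ → X
tail xs i = xs (suc i)

module _ (A : tNCW) where
  open tNCW A

  private variable
    p p' q q' r r' : Q A
    σ : Letter A
    w : Word A
    ρ : ℕ → Q A

  _∷ʷ_ : Letter A → Word A → Word A
  (σ ∷ʷ w) zero = σ
  (σ ∷ʷ w) (suc i) = w i

  _∷ᵠ_ : Q A → (ℕ → Q A) → ℕ → Q A
  (q ∷ᵠ ρ) zero = q
  (q ∷ᵠ ρ) (suc i) = ρ i

  IsRun-∷ : T (Δ q σ q') → IsRun A q' w ρ → IsRun A q (σ ∷ʷ w) (q ∷ᵠ ρ)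
  IsRun-∷ δ (refl , steps) = refl , λ { zero → δ ; (suc i) → steps i }

  IsRun-tail : IsRun A q w ρ → IsRun A (ρ 1) (tail w) (tail ρ)
  IsRun-tail (_ , steps) = refl , λ i → steps (suc i)

  Accepting-∷ : Accepting A w ρ → Accepting A (σ ∷ʷ w) (q ∷ᵠ ρ)
  Accepting-∷ (n , safeAfter) = suc n , λ { zero () ; (suc i) (s≤s n≤i) → safeAfter i n≤i }

  Accepting-tail : Accepting A w ρ → Accepting A (tail w) (tail ρ)
  Accepting-tail (n , safeAfter) = n , λ i n≤i → safeAfter (suc i) (≤-trans n≤i (n≤1+n i))

  SafeRun-∷ : ¬ T (α q σ q') → IsRun A q' w ρ → SafeRun A w ρ → SafeRun A (σ ∷ʷ w) (q ∷ᵠ ρ)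
  SafeRun-∷ a (refl , _) safe zero = a
  SafeRun-∷ a _ safe (suc i) = safe i

  Lang-∷ : T (Δ q σ q') → Lang A q' w → Lang A q (σ ∷ʷ w)
  Lang-∷ δ (ρ , run , acc) = _ , IsRun-∷ δ run , Accepting-∷ acc

  Lang-tail : Lang A q w → ∃ λ q' → T (Δ q (w 0) q') × Lang A q' (tail w)
  Lang-tail (ρ , run@(refl , steps) , acc) = ρ 1 , steps 0 , tail ρ , IsRun-tail run , Accepting-tail acc

  LangSafe-∷ : T (Δ q σ q') → ¬ T (α q σ q') → LangSafe A q' w → LangSafe A q (σ ∷ʷ w)
  LangSafe-∷ δ a (ρ , run , safe) = _ , IsRun-∷ δ run , SafeRun-∷ a run safe

  LangSafe-tail : LangSafe A q w →
                  ∃ λ q' → T (Δ q (w 0) q') × ¬ T (α q (w 0) q') × LangSafe A q' (tail w)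
  LangSafe-tail (ρ , run@(refl , steps) , safe) =
    ρ 1 , steps 0 , safe 0 , tail ρ , IsRun-tail run , λ i → safe (suc i)

  LangSafe-nonempty-on-invariant : (P : Q A → Set) →
    (∀ {x} → P x → ∃ λ x' → SafeEdge A x x' × P x') →
    ∀ {x} → P x → ∃ (LangSafe A x)
  LangSafe-nonempty-on-invariant P extend {x} px = word , state , (refl , λ i → proj₁ (proj₂ (edge i))) ,
                                                   λ i → proj₂ (proj₂ (edge i))
    where
    orbit : ℕ → Σ (Q A) P
    orbit zero = x , px
    orbit (suc i) = proj₁ (extend (proj₂ (orbit i))) , proj₂ (proj₂ (extend (proj₂ (orbit i))))

    state : ℕ → Q A
    state i = proj₁ (orbit i)

    edge : ∀ i → SafeEdge A (state i) (state (suc i))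
    edge i = proj₁ (proj₂ (extend (proj₂ (orbit i))))

    word : Word A
    word i = proj₁ (edge i)

  SafeEdge-continues : Normal A → ∀ {q q'} → SafeEdge A q q' → ∃ (SafeEdge A q')
  SafeEdge-continues normal {q' = q'} e with normal _ _ (e ◅ ε)
  ... | ε = q' , e
  ... | e' ◅ _ = _ , e'

  LangSafe-nonempty-after-SafeEdge : Normal A → SafeEdge A q q' → ∃ (LangSafe A q')
  LangSafe-nonempty-after-SafeEdge normal e =
    LangSafe-nonempty-on-invariant (λ x → ∃ (SafeEdge A x))
      (λ (x' , e') → x' , e' , SafeEdge-continues normal e')
      (SafeEdge-continues normal e)

  Lang-⊆-step : SemanticallyDeterministic A → (∀ w → Lang A p w → Lang A r w) →
                T (Δ p σ p') → T (Δ r σ r') → ∀ w → Lang A p' w → Lang A r' w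
  Lang-⊆-step semDet p⊆r δp δr w l with Lang-tail (p⊆r _ (Lang-∷ δp l))
  ... | s , δs , ls = proj₁ (semDet _ _ _ _ δs δr w) ls

  ∼-step : SemanticallyDeterministic A → _∼_ A p r →
           T (Δ p σ p') → T (Δ r σ r') → _∼_ A p' r'
  ∼-step semDet p∼r δp δr w =
    Lang-⊆-step semDet (λ v → proj₁ (p∼r v)) δp δr w , Lang-⊆-step semDet (λ v → proj₂ (p∼r v)) δr δp w

  LangSafe-⊆-step : SafeDeterministic A → (∀ w → LangSafe A p w → LangSafe A r w) →
                    T (Δ p σ p') → ¬ T (α p σ p') → T (Δ r σ r') → ¬ T (α r σ r') →
                    ∀ w → LangSafe A p' w → LangSafe A r' w
  LangSafe-⊆-step safeDet p⊆r δp ap δr ar w l with LangSafe-tail (p⊆r _ (LangSafe-∷ δp ap l))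
  ... | s , δs , as , ls = subst (λ t → LangSafe A t w) (safeDet _ _ _ _ δs as δr ar) ls

  ≾-simulates-SafeEdge : Normal A → SafeDeterministic A → SemanticallyDeterministic A →
                         _≾_ A p r → SafeEdge A p p' → ∃ λ r' → SafeEdge A r r' × _≾_ A p' r'
  ≾-simulates-SafeEdge normal safeDet semDet (p∼r , p⊆r) e@(σ , δp , ap)
    with LangSafe-nonempty-after-SafeEdge normal e
  ... | w , l with LangSafe-tail (p⊆r _ (LangSafe-∷ δp ap l))
  ... | r' , δr , ar , _ =
    r' , (σ , δr , ar) , ∼-step semDet p∼r δp δr , LangSafe-⊆-step safeDet p⊆r δp ap δr ar

  ≾-simulates-SafeReach : Normal A → SafeDeterministic A → SemanticallyDeterministic A →
                          _≾_ A p r → SafeReach A p p' → ∃ λ r' → SafeReach A r r' × _≾_ A p' r'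
  ≾-simulates-SafeReach _ _ _ p≾r ε = _ , ε , p≾r
  ≾-simulates-SafeReach normal safeDet semDet p≾r (e ◅ path)
    with ≾-simulates-SafeEdge normal safeDet semDet p≾r e
  ... | s , e' , next≾s with ≾-simulates-SafeReach normal safeDet semDet next≾s path
  ... | r' , path' , p'≾r' = r' , e' ◅ path' , p'≾r'

  ≾-trans : _≾_ A p q → _≾_ A q r → _≾_ A p r
  ≾-trans (p∼q , p⊆q) (q∼r , q⊆r) =
    (λ w → (λ l → proj₁ (q∼r w) (proj₁ (p∼q w) l)) , (λ l → proj₂ (p∼q w) (proj₂ (q∼r w) l))) ,
    (λ w l → q⊆r w (p⊆q w l))

  SafeComponent-connected : {S : Subset nQ} → IsSafeComponent A S → q ∈ S → q' ∈ S → SafeReach A q q'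
  SafeComponent-connected (_ , member) q∈S q'∈S =
    proj₂ (proj₁ (member _) q∈S) ◅◅ proj₁ (proj₁ (member _) q'∈S)

  SafeComponent-closed : {S : Subset nQ} → Normal A → IsSafeComponent A S →
                         q ∈ S → SafeReach A q q' → q' ∈ S
  SafeComponent-closed normal (_ , member) q∈S q⇝q' =
    proj₂ (member _) ( proj₁ (proj₁ (member _) q∈S) ◅◅ q⇝q'
                     , normal _ _ q⇝q' ◅◅ proj₂ (proj₁ (member _) q∈S))

lemma3p9 : (A : tNCW) → Nice A →
    (S S' S'' : Subset (tNCW.nQ A)) →
    IsSafeComponent A S → IsSafeComponent A S' → IsSafeComponent A S'' →
    H A S S' → H A S' S'' → H A S S''
lemma3p9 A (_ , _ , _ , normal , safeDet , semDet) _ _ _ _ S'-comp S''-comp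
  (q , p , q∈S , p∈S' , q≾p) (p' , r , p'∈S' , r∈S'' , p'≾r)
  with ≾-simulates-SafeReach A normal safeDet semDet p'≾r (SafeComponent-connected A S'-comp p'∈S' p∈S')
... | r' , r⇝r' , p≾r' =
  q , r' , q∈S , SafeComponent-closed A normal S''-comp r∈S'' r⇝r' , ≾-trans A q≾p p≾r'
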